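{- If $\lambda$ and $\mu$ are Latin partitions, then $\lambda+\mu$ is Latin.
   Context: $\lambda+\mu$ is the partition whose $i$th part is $\lambda_i+\mu_i$ (missing parts treated as $0$). A tableau of shape $\lambda$ is the Young diagram of $\lambda$ with a positive integer in each cell. $\lambda'$ denotes the conjugate partition. $\lambda$ is Latin if there is a tableau of shape $\lambda$ in which no two cells in the same row or column have equal entries and in which, for every $i$, the integer $i$ occurs exactly $\lambda'_i$ times. -}

module Defs where

open import Data.Nat using (ℕ; zero; suc; _+_; _≤_; _<_; _≥_; _≤?_; _≟_)
open import Data.List using (List; []; _∷_; length; filter; map; upTo; concatMap)
open import Data.List.Relation.Unary.All using (All)
open import Data.List.Relation.Unary.Linked using (Linked)
open import Data.Product using (Σ; _×_; _,_; proj₁; proj₂)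
open import Relation.Binary.PropositionalEquality using (_≡_; _≢_)

IsPartition : List ℕ → Set
IsPartition λs = Linked _≥_ λs × All (λ x → 1 ≤ x) λs

-- part λ r : the (r+1)-th part (0-indexed row r), 0 if missing.
part : List ℕ → ℕ → ℕ
part []       _       = 0
part (x ∷ _)  zero    = x
part (_ ∷ xs) (suc r) = part xs r

_⊕_ : List ℕ → List ℕ → List ℕ
[]       ⊕ ys       = ys
(x ∷ xs) ⊕ []       = x ∷ xs
(x ∷ xs) ⊕ (y ∷ ys) = (x + y) ∷ (xs ⊕ ys)

-- conjugate: conj λ i = λ'_i = number of parts ≥ i (meaningful for i ≥ 1).
conj : List ℕ → ℕ → ℕ
conj λs i = length (filter (λ x → i ≤? x) λs)

cells : List ℕ → List (ℕ × ℕ)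
cells λs = concatMap (λ r → map (λ c → (r , c)) (upTo (part λs r))) (upTo (length λs))

InShape : List ℕ → ℕ → ℕ → Set
InShape λs r c = c < part λs r

-- A tableau of shape λ is given by T : ℕ → ℕ → ℕ (only its values on cells matter).
-- λ is Latin if some tableau has positive entries, no repeated entry in a row
-- or column, and each i ≥ 1 occurs exactly λ'_i times.
Latin : List ℕ → Set
Latin λs = Σ (ℕ → ℕ → ℕ) λ T →
    (∀ r c → InShape λs r c → 1 ≤ T r c)
  × (∀ r c c' → InShape λs r c → InShape λs r c' → c ≢ c' → T r c ≢ T r c')
  × (∀ r r' c → InShape λs r c → InShape λs r' c → r ≢ r' → T r c ≢ T r' c)
  × (∀ i → 1 ≤ i →
       length (filter (λ rc → T (proj₁ rc) (proj₂ rc) ≟ i) (cells λs)) ≡ conj λs i)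

-- Row r of λ + μ has length λ_r + μ_r: the number of columns of λ taller than r plus the number
-- of columns of μ taller than r. So the columns of λ + μ are those of λ and of μ, sorted by
-- decreasing height, and listing them in that order (`merge`) is a height-preserving bijection
-- from the columns of λ and μ onto the columns of λ + μ which keeps every cell in its row.
-- Let T and S be Latin tableaux of λ and μ. In T the entry i occurs λ'_i times, as many times as
-- column i - 1 of λ has cells, so entries can be renamed by the same bijection. The tableau U
-- of λ + μ carries in column c the column of T or S that merges to c, with every entry i of T
-- renamed to 1 + merge (column i - 1 of λ), and similarly for S. Each column of U is a column
-- of T or S and the renaming is injective, so rows and columns of U have distinct entries; and
-- an entry 1 + c occurs in U as often as its preimage does in T or S, which is the height
-- (λ + μ)'_{c+1} of column c.

module Submission where

open import Data.Bool using (true; false)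
open import Data.List using (List; []; _∷_; [_]; _++_; length; filter; map; upTo; applyUpTo; concatMap)
open import Data.List.Membership.Propositional using (_∈_; lose)
open import Data.List.Membership.Propositional.Properties
  using (∈-map⁺; ∈-upTo⁺; ∈-concatMap⁺)
open import Data.List.Properties
  using (filter-accept; filter-reject; filter-none; filter-some; filter-++; length-++
        ; map-upTo; upTo-∷ʳ)
open import Data.List.Relation.Unary.All.Properties using (applyUpTo⁺₁)
open import Data.List.Relation.Unary.Linked using (Linked; _∷_)
import Data.List.Relation.Unary.Linked as Linked
open import Data.Nat
open import Data.Nat.ListAction using (sum)
open import Data.Nat.Properties
open import Data.Product using (∃; _×_; _,_; proj₁; proj₂)
open import Data.Sum using (_⊎_; inj₁; inj₂)
open import Data.Sum.Properties using (inj₁-injective; inj₂-injective)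
open import Function using (_∘_; _⇔_; mk⇔; Equivalence)
open import Function.Construct.Composition using (_⇔-∘_)
open import Level using (0ℓ)
open import Relation.Binary.PropositionalEquality
  using (_≡_; _≢_; refl; sym; trans; cong; cong₂; subst; subst₂; module ≡-Reasoning)
open import Relation.Nullary using (¬_; does; yes; no; contradiction)
open import Relation.Nullary.Decidable using (decidable-stable)
open import Relation.Unary using (Pred; Decidable)

open import Defs

open Equivalence using (to; from)

Antitone : (ℕ → ℕ) → Set
Antitone f = ∀ {m n} → m ≤ n → f n ≤ f m

≤-via-< : ∀ {m n} → (∀ {a} → a < m → a < n) → m ≤ n
≤-via-< {zero}  _    = z≤n
≤-via-< {suc m} m<⇒n< = m<⇒n< ≤-refl

≡-via-< : ∀ {m n} → (∀ {a} → a < m → a < n) → (∀ {a} → a < n → a < m) → m ≡ n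
≡-via-< m<⇒n< n<⇒m< = ≤-antisym (≤-via-< m<⇒n<) (≤-via-< n<⇒m<)

part-antitone : ∀ {L} → Linked _≥_ L → Antitone (part L)
part-antitone {[]}         _         _                          = z≤n
part-antitone {x ∷ xs}     _         {zero}  {zero}  _          = ≤-refl
part-antitone {x ∷ []}     _         {zero}  {suc n} _          = z≤n
part-antitone {x ∷ y ∷ ys} (x≥y ∷ l) {zero}  {suc n} _          =
  ≤-trans (part-antitone l (z≤n {n})) x≥y
part-antitone {x ∷ xs}     l         {suc m} {suc n} (s≤s m≤n)  =
  part-antitone (Linked.tail l) m≤n

conj-duality : ∀ {L} → Antitone (part L) → ∀ r a → r < conj L (suc a) ⇔ a < part L r
conj-duality {[]}     _    r a = mk⇔ (λ ()) (λ ())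
conj-duality {x ∷ xs} anti r a with suc a ≤? x
... | yes a<x = subst (λ n → r < n ⇔ a < part (x ∷ xs) r)
                      (sym (cong length (filter-accept (suc a ≤?_) a<x))) (accepted r)
  where
  accepted : ∀ r → r < suc (conj xs (suc a)) ⇔ a < part (x ∷ xs) r
  accepted zero    = mk⇔ (λ _ → a<x) (λ _ → z<s)
  accepted (suc r) = mk⇔ (to (conj-duality {xs} (anti ∘ s≤s) r a) ∘ s<s⁻¹)
                         (s<s ∘ from (conj-duality {xs} (anti ∘ s≤s) r a))
... | no a≮x = subst (λ n → r < n ⇔ a < part (x ∷ xs) r)
                     (sym (cong length (filter-reject (suc a ≤?_) a≮x)))
                     (mk⇔ (λ r<h → contradiction (to (conj-duality {xs} (anti ∘ s≤s) r a) r<h)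
                                                 (rejected (suc r)))
                          (λ a<p → contradiction a<p (rejected r)))
  where
  rejected : ∀ r → ¬ a < part (x ∷ xs) r
  rejected r a<p = a≮x (≤-trans a<p (anti (z≤n {r})))

part-⊕ : ∀ xs ys r → part (xs ⊕ ys) r ≡ part xs r + part ys r
part-⊕ []       ys       r       = refl
part-⊕ (x ∷ xs) []       r       = sym (+-identityʳ _)
part-⊕ (x ∷ xs) (y ∷ ys) zero    = refl
part-⊕ (x ∷ xs) (y ∷ ys) (suc r) = part-⊕ xs ys r

length-⊕ : ∀ xs ys → length (xs ⊕ ys) ≡ length xs ⊔ length ys
length-⊕ []       ys       = refl
length-⊕ (x ∷ xs) []       = refl
length-⊕ (x ∷ xs) (y ∷ ys) = cong suc (length-⊕ xs ys)

-- h gives the column heights of the diagram with row lengths p: cell (r, a) lies in it iff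
-- r < h a iff a < p r.
module Duality {p h : ℕ → ℕ} (dual : ∀ r a → r < h a ⇔ a < p r) where

  dual⇒antitone : Antitone p
  dual⇒antitone {m} {n} m≤n =
    ≤-via-< λ {a} a<pn → to (dual m a) (≤-<-trans m≤n (from (dual n a) a<pn))

  <-part[pred-height] : ∀ {a} → 0 < h a → a < p (pred (h a))
  <-part[pred-height] 0<h = to (dual _ _) (m≤pred[n]⇒suc[m]≤n {{>-nonZero 0<h}} ≤-refl)

  part[height]≤ : ∀ a → p (h a) ≤ a
  part[height]≤ a = ≮⇒≥ (λ a<p → <-irrefl refl (from (dual (h a) a) a<p))

  height≡suc : ∀ {a} k → a < p k → p (suc k) ≤ a → h a ≡ suc k
  height≡suc {a} k a<p p≤a =
    ≤-antisym (≮⇒≥ λ k<h → <⇒≱ (to (dual (suc k) a) k<h) p≤a) (from (dual k a) a<p)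

  height≡0 : ∀ {a} → p 0 ≤ a → h a ≡ 0
  height≡0 {a} p≤a = n≤0⇒n≡0 (≮⇒≥ λ 0<h → <⇒≱ (to (dual 0 a) 0<h) p≤a)

  offset-dual : ∀ {g} → Antitone g → ∀ {a o} → g (h a) ≤ o → o ≤ g (pred (h a)) →
                ∀ r → r < h a ⇔ a + o < p r + g r
  offset-dual {g} g-antitone {a} {o} g[h]≤o o≤g[pred-h] r = mk⇔
    (λ r<h → +-mono-<-≤ (to (dual r a) r<h)
                         (≤-trans o≤g[pred-h] (g-antitone (<⇒≤pred r<h))))
    (λ a+o< → ≰⇒> λ h≤r → <⇒≱ a+o<
      (+-mono-≤ (≤-trans (dual⇒antitone h≤r) (part[height]≤ a))
                (≤-trans (g-antitone h≤r) g[h]≤o)))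

module Merge {p q h₁ h₂ H : ℕ → ℕ}
  (h₁-dual : ∀ r a → r < h₁ a ⇔ a < p r)
  (h₂-dual : ∀ r b → r < h₂ b ⇔ b < q r)
  (H-dual  : ∀ r c → r < H c ⇔ c < p r + q r)
  where

  open Duality

  p-antitone : Antitone p
  p-antitone = dual⇒antitone h₁-dual

  q-antitone : Antitone q
  q-antitone = dual⇒antitone h₂-dual

  height : ℕ ⊎ ℕ → ℕ
  height (inj₁ a) = h₁ a
  height (inj₂ b) = h₂ b

  InRow : ℕ → ℕ ⊎ ℕ → Set
  InRow r (inj₁ a) = a < p r
  InRow r (inj₂ b) = b < q r

  -- The columns of both diagrams listed by decreasing height, those of p first among equal
  -- heights: column a of p, of height h, is preceded by the a columns of p before it and the
  -- q h columns of q taller than h; column b of q, of height h, by the b columns of q before it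
  -- and the p (h - 1) columns of p at least as tall.
  merge : ℕ ⊎ ℕ → ℕ
  merge (inj₁ a) = a + q (h₁ a)
  merge (inj₂ b) = b + p (pred (h₂ b))

  merge-dual : ∀ r s → r < height s ⇔ merge s < p r + q r
  merge-dual r (inj₁ a) = offset-dual h₁-dual q-antitone ≤-refl (q-antitone pred[n]≤n) r
  merge-dual r (inj₂ b) = subst (λ n → r < h₂ b ⇔ merge (inj₂ b) < n) (+-comm (q r) (p r))
    (offset-dual h₂-dual p-antitone (p-antitone pred[n]≤n) ≤-refl r)

  height-merge : ∀ s → H (merge s) ≡ height s
  height-merge s = ≡-via-< (λ {r} → from (merge-dual r s) ∘ to (H-dual r _))
                           (λ {r} → from (H-dual r _) ∘ to (merge-dual r s))

  inRow-dual : ∀ r s → r < height s ⇔ InRow r s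
  inRow-dual r (inj₁ a) = h₁-dual r a
  inRow-dual r (inj₂ b) = h₂-dual r b

  inRow⇒0<height : ∀ {r s} → InRow r s → 0 < height s
  inRow⇒0<height {r} {s} = ≤-<-trans z≤n ∘ from (inRow-dual r s)

  merge-<-row : ∀ {r s} → InRow r s → merge s < p r + q r
  merge-<-row {r} {s} = to (merge-dual r s) ∘ from (inRow-dual r s)

  merge≡⇒height≡ : ∀ {s t} → merge s ≡ merge t → height s ≡ height t
  merge≡⇒height≡ {s} {t} eq = trans (sym (height-merge s)) (trans (cong H eq) (height-merge t))

  merge-inj₁<merge-inj₂ : ∀ {a b} → 0 < h₁ a → h₁ a ≡ h₂ b →
                          merge (inj₁ a) < merge (inj₂ b)
  merge-inj₁<merge-inj₂ {a} {b} 0<h h≡ = begin-strict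
    a + q (h₁ a)
      <⟨ +-mono-<-≤ (<-part[pred-height] h₁-dual 0<h) (≤-reflexive (cong q h≡)) ⟩
    p (pred (h₁ a)) + q (h₂ b)
      ≤⟨ +-mono-≤ (≤-reflexive (cong (p ∘ pred) h≡)) (part[height]≤ h₂-dual b) ⟩
    p (pred (h₂ b)) + b
      ≡⟨ +-comm _ b ⟩
    b + p (pred (h₂ b))
      ∎
    where open ≤-Reasoning

  merge-injective : ∀ {s t} → 0 < height s → merge s ≡ merge t → s ≡ t
  merge-injective {inj₁ a} {inj₁ a'} _ eq =
    cong inj₁ (+-cancelʳ-≡ _ a a' (trans eq (cong (λ h → a' + q h) (sym h≡))))
    where
    h≡ : h₁ a ≡ h₁ a'
    h≡ = merge≡⇒height≡ {inj₁ a} {inj₁ a'} eq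
  merge-injective {inj₂ b} {inj₂ b'} _ eq =
    cong inj₂ (+-cancelʳ-≡ _ b b' (trans eq (cong (λ h → b' + p (pred h)) (sym h≡))))
    where
    h≡ : h₂ b ≡ h₂ b'
    h≡ = merge≡⇒height≡ {inj₂ b} {inj₂ b'} eq
  merge-injective {inj₁ a} {inj₂ b} 0<h eq =
    contradiction eq (<⇒≢ (merge-inj₁<merge-inj₂ 0<h h≡))
    where
    h≡ : h₁ a ≡ h₂ b
    h≡ = merge≡⇒height≡ {inj₁ a} {inj₂ b} eq
  merge-injective {inj₂ b} {inj₁ a} 0<h eq =
    contradiction (sym eq) (<⇒≢ (merge-inj₁<merge-inj₂ (subst (0 <_) h≡ 0<h) (sym h≡)))
    where
    h≡ : h₂ b ≡ h₁ a
    h≡ = merge≡⇒height≡ {inj₂ b} {inj₁ a} eq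

  -- Positions of the columns of height k + 1 start at p (k + 1) + q (k + 1), those of p first,
  -- and the ones of p end at p k + q (k + 1). Any column of height 0 will do for height 0.
  unmergeAt : ℕ → ℕ → ℕ ⊎ ℕ
  unmergeAt zero    c = inj₂ c
  unmergeAt (suc k) c with c <? p k + q (suc k)
  ... | yes _ = inj₁ (c ∸ q (suc k))
  ... | no  _ = inj₂ (c ∸ p k)

  unmerge : ℕ → ℕ ⊎ ℕ
  unmerge c = unmergeAt (H c) c

  part[H]≤ : ∀ c → p (H c) + q (H c) ≤ c
  part[H]≤ = part[height]≤ H-dual

  merge-unmergeAt : ∀ {c k} → H c ≡ suc k → merge (unmergeAt (suc k) c) ≡ c
  merge-unmergeAt {c} {k} Hc≡ with c <? p k + q (suc k)
  ... | yes c< = trans (cong (λ h → a + q h) (height≡suc h₁-dual k a<p p≤a)) a+q≡c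
    where
    lower : p (suc k) + q (suc k) ≤ c
    lower = subst (λ h → p h + q h ≤ c) Hc≡ (part[H]≤ c)
    a : ℕ
    a = c ∸ q (suc k)
    a+q≡c : a + q (suc k) ≡ c
    a+q≡c = m∸n+n≡m (≤-trans (m≤n+m (q (suc k)) (p (suc k))) lower)
    a<p : a < p k
    a<p = +-cancelʳ-< _ _ _ (subst (_< p k + q (suc k)) (sym a+q≡c) c<)
    p≤a : p (suc k) ≤ a
    p≤a = +-cancelʳ-≤ _ _ _ (subst (p (suc k) + q (suc k) ≤_) (sym a+q≡c) lower)
  ... | no c≮ =
    trans (cong (λ h → b + p (pred h)) (height≡suc h₂-dual k b<q q≤b)) (trans (+-comm b _) p+b≡c)
    where
    upper : c < p k + q k
    upper = to (H-dual k c) (≤-reflexive (sym Hc≡))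
    b : ℕ
    b = c ∸ p k
    p+b≡c : p k + b ≡ c
    p+b≡c = m+[n∸m]≡n (≤-trans (m≤m+n (p k) (q (suc k))) (≮⇒≥ c≮))
    b<q : b < q k
    b<q = +-cancelˡ-< _ _ _ (subst (_< p k + q k) (sym p+b≡c) upper)
    q≤b : q (suc k) ≤ b
    q≤b = +-cancelˡ-≤ _ _ _ (subst (p k + q (suc k) ≤_) (sym p+b≡c) (≮⇒≥ c≮))

  merge-unmerge : ∀ {c} → 0 < H c → merge (unmerge c) ≡ c
  merge-unmerge {c} 0<H with H c in eq
  ... | suc k = merge-unmergeAt eq

  height-unmerge : ∀ c → height (unmerge c) ≡ H c
  height-unmerge c with H c in eq
  ... | zero  =
    height≡0 h₂-dual (≤-trans (m≤n+m (q 0) (p 0)) (subst (λ h → p h + q h ≤ c) eq (part[H]≤ c)))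
  ... | suc k = trans (sym (height-merge (unmergeAt (suc k) c))) (trans (cong H (merge-unmergeAt eq)) eq)

  unmerge-merge : ∀ {s} → 0 < height s → unmerge (merge s) ≡ s
  unmerge-merge {s} 0<h = sym (merge-injective {s} 0<h (sym (merge-unmerge {merge s} 0<H)))
    where
    0<H : 0 < H (merge s)
    0<H = subst (0 <_) (sym (height-merge s)) 0<h

  unmerge-inRow : ∀ {r c} → c < p r + q r → InRow r (unmerge c)
  unmerge-inRow {r} {c} c< =
    to (inRow-dual r _) (subst (r <_) (sym (height-unmerge c)) (from (H-dual r c) c<))

  row⇒0<H : ∀ {r c} → c < p r + q r → 0 < H c
  row⇒0<H {r} {c} c< = ≤-<-trans z≤n (from (H-dual r c) c<)

  unmerge-injective : ∀ {c c'} → 0 < H c → 0 < H c' → unmerge c ≡ unmerge c' → c ≡ c'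
  unmerge-injective {c} {c'} 0<Hc 0<Hc' eq = begin
    c                  ≡⟨ merge-unmerge 0<Hc ⟨
    merge (unmerge c)  ≡⟨ cong merge eq ⟩
    merge (unmerge c') ≡⟨ merge-unmerge 0<Hc' ⟩
    c'                 ∎
    where open ≡-Reasoning

module _ {A B : Set} {P : Pred B 0ℓ} (P? : Decidable P) where

  length-filter-map : ∀ (f : A → B) xs →
                      length (filter P? (map f xs)) ≡ length (filter (P? ∘ f) xs)
  length-filter-map f []       = refl
  length-filter-map f (x ∷ xs) with does (P? (f x))
  ... | true  = cong suc (length-filter-map f xs)
  ... | false = length-filter-map f xs

  length-filter-concatMap : ∀ (g : A → List B) xs →
    length (filter P? (concatMap g xs)) ≡ sum (map (length ∘ filter P? ∘ g) xs)
  length-filter-concatMap g []       = refl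
  length-filter-concatMap g (x ∷ xs) = begin
    length (filter P? (g x ++ concatMap g xs))
      ≡⟨ cong length (filter-++ P? (g x) _) ⟩
    length (filter P? (g x) ++ filter P? (concatMap g xs))
      ≡⟨ length-++ (filter P? (g x)) ⟩
    length (filter P? (g x)) + length (filter P? (concatMap g xs))
      ≡⟨ cong (_ +_) (length-filter-concatMap g xs) ⟩
    length (filter P? (g x)) + sum (map (length ∘ filter P? ∘ g) xs)
      ∎
    where open ≡-Reasoning

applyUpTo-cong : ∀ {A : Set} {f g : ℕ → A} → (∀ r → f r ≡ g r) → ∀ n →
                 applyUpTo f n ≡ applyUpTo g n
applyUpTo-cong f≗g zero    = refl
applyUpTo-cong f≗g (suc n) = cong₂ _∷_ (f≗g 0) (applyUpTo-cong (f≗g ∘ suc) n)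

sum-applyUpTo-extend : ∀ (f : ℕ → ℕ) {m n} → m ≤ n → (∀ {r} → m ≤ r → f r ≡ 0) →
                       sum (applyUpTo f n) ≡ sum (applyUpTo f m)
sum-applyUpTo-extend f {zero}  {zero}  _         zeros = refl
sum-applyUpTo-extend f {zero}  {suc n} _         zeros =
  cong₂ _+_ (zeros z≤n) (sum-applyUpTo-extend (f ∘ suc) (z≤n {n}) (λ _ → zeros z≤n))
sum-applyUpTo-extend f {suc m} {suc n} (s≤s m≤n) zeros =
  cong (f 0 +_) (sum-applyUpTo-extend (f ∘ suc) m≤n (zeros ∘ s≤s))

occurrences : (ℕ → ℕ) → ℕ → ℕ → ℕ
occurrences f n i = length (filter (λ c → f c ≟ i) (upTo n))

Occurs : (ℕ → ℕ) → ℕ → ℕ → Set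
Occurs f n i = ∃ λ c → c < n × f c ≡ i

InjectiveBelow : ℕ → (ℕ → ℕ) → Set
InjectiveBelow n f = ∀ {c c'} → c < n → c' < n → f c ≡ f c' → c ≡ c'

occurrences-suc : ∀ f n i →
  occurrences f (suc n) i ≡ occurrences f n i + length (filter (λ c → f c ≟ i) [ n ])
occurrences-suc f n i = begin
  length (filter P? (upTo (suc n)))          ≡⟨ cong (length ∘ filter P?) (upTo-∷ʳ n) ⟨
  length (filter P? (upTo n ++ [ n ]))        ≡⟨ cong length (filter-++ P? (upTo n) [ n ]) ⟩
  length (filter P? (upTo n) ++ filter P? [ n ]) ≡⟨ length-++ (filter P? (upTo n)) ⟩
  occurrences f n i + length (filter P? [ n ]) ∎
  where
  open ≡-Reasoning
  P? : Decidable (λ c → f c ≡ i)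
  P? c = f c ≟ i

occurrences-absent : ∀ {f n i} → ¬ Occurs f n i → occurrences f n i ≡ 0
occurrences-absent {f} {n} {i} ¬occ =
  cong length (filter-none (λ c → f c ≟ i) (applyUpTo⁺₁ _ n λ c< fc≡i → ¬occ (_ , c< , fc≡i)))

occurrences-unique : ∀ {f n i c} → InjectiveBelow n f → c < n → f c ≡ i → occurrences f n i ≡ 1
occurrences-unique {f} {suc n} {i} {c} inj c< fc≡i with c ≟ n
... | yes refl =
  trans (occurrences-suc f n i) (cong₂ _+_ (occurrences-absent ¬occ) (cong length (filter-accept P? fc≡i)))
  where
  P? : Decidable (λ c → f c ≡ i)
  P? c = f c ≟ i
  ¬occ : ¬ Occurs f n i
  ¬occ (c' , c'< , fc'≡i) = <-irrefl (inj (m<n⇒m<1+n c'<) ≤-refl (trans fc'≡i (sym fc≡i))) c'<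
... | no c≢n = trans (occurrences-suc f n i)
    (cong₂ _+_ (occurrences-unique inj-below (≤∧≢⇒< (s≤s⁻¹ c<) c≢n) fc≡i)
               (cong length (filter-reject P? fn≢i)))
  where
  P? : Decidable (λ c → f c ≡ i)
  P? c = f c ≟ i
  inj-below : InjectiveBelow n f
  inj-below c< c'< = inj (m<n⇒m<1+n c<) (m<n⇒m<1+n c'<)
  fn≢i : f n ≢ i
  fn≢i fn≡i = c≢n (inj c< ≤-refl (trans fc≡i (sym fn≡i)))

occurrences-≡ : ∀ {f g m n i j} → InjectiveBelow m f → InjectiveBelow n g →
                Occurs f m i ⇔ Occurs g n j → occurrences f m i ≡ occurrences g n j
occurrences-≡ {f} {m = m} {i = i} f-inj g-inj occurs⇔ with anyUpTo? (λ c → f c ≟ i) m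
... | yes occ@(_ , c< , fc≡i) =
  let _ , d< , gd≡j = to occurs⇔ occ in
  trans (occurrences-unique f-inj c< fc≡i) (sym (occurrences-unique g-inj d< gd≡j))
... | no ¬occ = trans (occurrences-absent ¬occ) (sym (occurrences-absent (¬occ ∘ from occurs⇔)))

count : (ℕ → ℕ → ℕ) → List ℕ → ℕ → ℕ
count T L i = length (filter (λ rc → T (proj₁ rc) (proj₂ rc) ≟ i) (cells L))

part-beyond-length : ∀ L {r} → length L ≤ r → part L r ≡ 0
part-beyond-length []      _                  = refl
part-beyond-length (x ∷ L) {suc r} (s≤s len≤r) = part-beyond-length L len≤r

<-part⇒<-length : ∀ L {r c} → c < part L r → r < length L
<-part⇒<-length (x ∷ L) {zero}  _  = z<s
<-part⇒<-length (x ∷ L) {suc r} c< = s<s (<-part⇒<-length L c<)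

∈-cells : ∀ L {r c} → c < part L r → (r , c) ∈ cells L
∈-cells L c< =
  ∈-concatMap⁺ _ (lose (∈-upTo⁺ (<-part⇒<-length L c<)) (∈-map⁺ _ (∈-upTo⁺ c<)))

count-by-rows : ∀ T L i {N} → length L ≤ N →
                count T L i ≡ sum (applyUpTo (λ r → occurrences (T r) (part L r) i) N)
count-by-rows T L i {N} len≤N = begin
  count T L i
    ≡⟨ length-filter-concatMap P? row (upTo (length L)) ⟩
  sum (map (length ∘ filter P? ∘ row) (upTo (length L)))
    ≡⟨ cong sum (map-upTo _ (length L)) ⟩
  sum (applyUpTo (length ∘ filter P? ∘ row) (length L))
    ≡⟨ cong sum (applyUpTo-cong row-occurrences (length L)) ⟩
  sum (applyUpTo rowOccurrences (length L))
    ≡⟨ sum-applyUpTo-extend rowOccurrences len≤N empty-rows ⟨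
  sum (applyUpTo rowOccurrences N)
    ∎
  where
  open ≡-Reasoning
  P? : Decidable (λ (rc : ℕ × ℕ) → T (proj₁ rc) (proj₂ rc) ≡ i)
  P? (r , c) = T r c ≟ i
  row : ℕ → List (ℕ × ℕ)
  row r = map (r ,_) (upTo (part L r))
  rowOccurrences : ℕ → ℕ
  rowOccurrences r = occurrences (T r) (part L r) i
  row-occurrences : ∀ r → length (filter P? (row r)) ≡ rowOccurrences r
  row-occurrences r = length-filter-map P? (r ,_) (upTo (part L r))
  empty-rows : ∀ {r} → length L ≤ r → rowOccurrences r ≡ 0
  empty-rows {r} len≤r = cong (λ n → occurrences (T r) n i) (part-beyond-length L len≤r)

Positive RowsDistinct ColumnsDistinct CountsConjugate : List ℕ → (ℕ → ℕ → ℕ) → Set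
Positive        L T = ∀ r c → InShape L r c → 1 ≤ T r c
RowsDistinct    L T = ∀ r c c' → InShape L r c → InShape L r c' → c ≢ c' → T r c ≢ T r c'
ColumnsDistinct L T = ∀ r r' c → InShape L r c → InShape L r' c → r ≢ r' → T r c ≢ T r' c
CountsConjugate L T = ∀ i → 1 ≤ i → count T L i ≡ conj L i

rowsDistinct⇒injective : ∀ {L T} → RowsDistinct L T → ∀ r → InjectiveBelow (part L r) (T r)
rowsDistinct⇒injective distinct r c< c'< eq =
  decidable-stable (_ ≟ _) λ c≢c' → distinct r _ _ c< c'< c≢c' eq

columnsDistinct⇒injective : ∀ {L T} → ColumnsDistinct L T →
  ∀ {r r' c} → InShape L r c → InShape L r' c → T r c ≡ T r' c → r ≡ r'
columnsDistinct⇒injective distinct c< c<' eq =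
  decidable-stable (_ ≟ _) λ r≢r' → distinct _ _ _ c< c<' r≢r' eq

entry-conj-positive : ∀ {L T} → Positive L T → CountsConjugate L T →
                      ∀ {r c} → InShape L r c → 0 < conj L (T r c)
entry-conj-positive {L} {T} T-pos T-counts {r} {c} c< =
  subst (0 <_) (T-counts (T r c) (T-pos r c c<)) (filter-some _ (lose (∈-cells L c<) refl))

module SumTableau (λs μs : List ℕ) {T S : ℕ → ℕ → ℕ}
  (λ-antitone : Antitone (part λs)) (μ-antitone : Antitone (part μs))
  (T-pos : Positive λs T) (T-rows : RowsDistinct λs T)
  (T-cols : ColumnsDistinct λs T) (T-counts : CountsConjugate λs T)
  (S-pos : Positive μs S) (S-rows : RowsDistinct μs S)
  (S-cols : ColumnsDistinct μs S) (S-counts : CountsConjugate μs S)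
  where

  ⊕-antitone : Antitone (part (λs ⊕ μs))
  ⊕-antitone {m} {n} m≤n = subst₂ _≤_ (sym (part-⊕ λs μs n)) (sym (part-⊕ λs μs m))
                                       (+-mono-≤ (λ-antitone m≤n) (μ-antitone m≤n))

  H-dual : ∀ r c → r < conj (λs ⊕ μs) (suc c) ⇔ c < part λs r + part μs r
  H-dual r c = subst (λ n → r < conj (λs ⊕ μs) (suc c) ⇔ c < n) (part-⊕ λs μs r)
                     (conj-duality {λs ⊕ μs} ⊕-antitone r c)

  open Merge (conj-duality {λs} λ-antitone) (conj-duality {μs} μ-antitone) H-dual

  inShape-⊕ : ∀ {r c} → InShape (λs ⊕ μs) r c → c < part λs r + part μs r
  inShape-⊕ {r} = subst (_ <_) (part-⊕ λs μs r)

  -- The entry over column s in row r, as a column: entry i of T or S stands for column i - 1.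
  symbol : ℕ → ℕ ⊎ ℕ → ℕ ⊎ ℕ
  symbol r (inj₁ a) = inj₁ (pred (T r a))
  symbol r (inj₂ b) = inj₂ (pred (S r b))

  U : ℕ → ℕ → ℕ
  U r c = suc (merge (symbol r (unmerge c)))

  T-nonZero : ∀ {r a} → a < part λs r → NonZero (T r a)
  T-nonZero {r} {a} a< = >-nonZero (T-pos r a a<)

  S-nonZero : ∀ {r b} → b < part μs r → NonZero (S r b)
  S-nonZero {r} {b} b< = >-nonZero (S-pos r b b<)

  T-pred-injective : ∀ {r r' a a'} → a < part λs r → a' < part λs r' →
                     pred (T r a) ≡ pred (T r' a') → T r a ≡ T r' a'
  T-pred-injective a< a'< = pred-injective ⦃ T-nonZero a< ⦄ ⦃ T-nonZero a'< ⦄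

  S-pred-injective : ∀ {r r' b b'} → b < part μs r → b' < part μs r' →
                     pred (S r b) ≡ pred (S r' b') → S r b ≡ S r' b'
  S-pred-injective b< b'< = pred-injective ⦃ S-nonZero b< ⦄ ⦃ S-nonZero b'< ⦄

  symbol-height : ∀ {r s} → InRow r s → 0 < height (symbol r s)
  symbol-height {r} {inj₁ a} a< = subst (λ t → 0 < conj λs t) (sym (suc-pred (T r a) ⦃ T-nonZero a< ⦄))
                                        (entry-conj-positive {λs} {T} T-pos T-counts a<)
  symbol-height {r} {inj₂ b} b< = subst (λ t → 0 < conj μs t) (sym (suc-pred (S r b) ⦃ S-nonZero b< ⦄))
                                        (entry-conj-positive {μs} {S} S-pos S-counts b<)

  T-row-injective : ∀ r → InjectiveBelow (part λs r) (T r)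
  T-row-injective = rowsDistinct⇒injective {λs} {T} T-rows

  S-row-injective : ∀ r → InjectiveBelow (part μs r) (S r)
  S-row-injective = rowsDistinct⇒injective {μs} {S} S-rows

  symbol-row-injective : ∀ {r s s'} → InRow r s → InRow r s' → symbol r s ≡ symbol r s' → s ≡ s'
  symbol-row-injective {r} {inj₁ a} {inj₁ a'} a< a'< eq =
    cong inj₁ (T-row-injective r a< a'< (T-pred-injective a< a'< (inj₁-injective eq)))
  symbol-row-injective {r} {inj₂ b} {inj₂ b'} b< b'< eq =
    cong inj₂ (S-row-injective r b< b'< (S-pred-injective b< b'< (inj₂-injective eq)))

  symbol-column-injective : ∀ {r r' s} → InRow r s → InRow r' s → symbol r s ≡ symbol r' s → r ≡ r'
  symbol-column-injective {s = inj₁ a} a< a<' eq =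
    columnsDistinct⇒injective {λs} {T} T-cols a< a<' (T-pred-injective a< a<' (inj₁-injective eq))
  symbol-column-injective {s = inj₂ b} b< b<' eq =
    columnsDistinct⇒injective {μs} {S} S-cols b< b<' (S-pred-injective b< b<' (inj₂-injective eq))

  U-row-injective : ∀ r → InjectiveBelow (part λs r + part μs r) (U r)
  U-row-injective r c< c'< eq =
    unmerge-injective (row⇒0<H c<) (row⇒0<H c'<)
      (symbol-row-injective (unmerge-inRow c<) (unmerge-inRow c'<)
        (merge-injective (symbol-height (unmerge-inRow c<)) (suc-injective eq)))

  U-column-injective : ∀ {r r' c} → c < part λs r + part μs r → c < part λs r' + part μs r' →
                       U r c ≡ U r' c → r ≡ r'
  U-column-injective c< c<' eq =
    symbol-column-injective (unmerge-inRow c<) (unmerge-inRow c<')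
      (merge-injective (symbol-height (unmerge-inRow c<)) (suc-injective eq))

  OccursSymbol : ℕ → ℕ ⊎ ℕ → Set
  OccursSymbol r σ = ∃ λ s → InRow r s × symbol r s ≡ σ

  U-occurs⇔ : ∀ r c → Occurs (U r) (part λs r + part μs r) (suc c) ⇔ OccursSymbol r (unmerge c)
  U-occurs⇔ r c = mk⇔
    (λ (c' , c'< , eq) → unmerge c' , unmerge-inRow c'< , (begin
      symbol r (unmerge c')
        ≡⟨ unmerge-merge (symbol-height (unmerge-inRow c'<)) ⟨
      unmerge (merge (symbol r (unmerge c')))
        ≡⟨ cong unmerge (suc-injective eq) ⟩
      unmerge c
        ∎))
    (λ (s , s∈ , eq) → merge s , merge-<-row s∈ , cong suc (begin
      merge (symbol r (unmerge (merge s)))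
        ≡⟨ cong (merge ∘ symbol r) (unmerge-merge {s} (inRow⇒0<height s∈)) ⟩
      merge (symbol r s)
        ≡⟨ cong merge eq ⟩
      merge (unmerge c)
        ≡⟨ merge-unmerge (subst (0 <_) (trans (cong height eq) (height-unmerge c)) (symbol-height s∈)) ⟩
      c
        ∎))
    where open ≡-Reasoning

  T-occurs⇔ : ∀ r a → OccursSymbol r (inj₁ a) ⇔ Occurs (T r) (part λs r) (suc a)
  T-occurs⇔ r a = mk⇔
    (λ { (inj₁ a' , a'< , eq) →
           a' , a'< , trans (sym (suc-pred (T r a') ⦃ T-nonZero a'< ⦄)) (cong suc (inj₁-injective eq)) })
    (λ (a' , a'< , eq) → inj₁ a' , a'< , cong (inj₁ ∘ pred) eq)

  S-occurs⇔ : ∀ r b → OccursSymbol r (inj₂ b) ⇔ Occurs (S r) (part μs r) (suc b)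
  S-occurs⇔ r b = mk⇔
    (λ { (inj₂ b' , b'< , eq) →
           b' , b'< , trans (sym (suc-pred (S r b') ⦃ S-nonZero b'< ⦄)) (cong suc (inj₂-injective eq)) })
    (λ (b' , b'< , eq) → inj₂ b' , b'< , cong (inj₂ ∘ pred) eq)

  symbolOccurrences : ℕ → ℕ ⊎ ℕ → ℕ
  symbolOccurrences r (inj₁ a) = occurrences (T r) (part λs r) (suc a)
  symbolOccurrences r (inj₂ b) = occurrences (S r) (part μs r) (suc b)

  U-occurrences : ∀ r c →
                  occurrences (U r) (part (λs ⊕ μs) r) (suc c) ≡ symbolOccurrences r (unmerge c)
  U-occurrences r c rewrite part-⊕ λs μs r with unmerge c | U-occurs⇔ r c
  ... | inj₁ a | occurs⇔ =
    occurrences-≡ (U-row-injective r) (T-row-injective r) (T-occurs⇔ r a ⇔-∘ occurs⇔)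
  ... | inj₂ b | occurs⇔ =
    occurrences-≡ (U-row-injective r) (S-row-injective r) (S-occurs⇔ r b ⇔-∘ occurs⇔)

  rows : ℕ
  rows = length (λs ⊕ μs)

  symbol-count : ∀ σ → sum (applyUpTo (λ r → symbolOccurrences r σ) rows) ≡ height σ
  symbol-count (inj₁ a) = trans (sym (count-by-rows T λs (suc a) λ≤rows)) (T-counts (suc a) (s≤s z≤n))
    where
    λ≤rows : length λs ≤ rows
    λ≤rows = subst (length λs ≤_) (sym (length-⊕ λs μs)) (m≤m⊔n _ _)
  symbol-count (inj₂ b) = trans (sym (count-by-rows S μs (suc b) μ≤rows)) (S-counts (suc b) (s≤s z≤n))
    where
    μ≤rows : length μs ≤ rows
    μ≤rows = subst (length μs ≤_) (sym (length-⊕ λs μs)) (m≤n⊔m _ _)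

  U-counts : CountsConjugate (λs ⊕ μs) U
  U-counts (suc c) _ = begin
    count U (λs ⊕ μs) (suc c)
      ≡⟨ count-by-rows U (λs ⊕ μs) (suc c) ≤-refl ⟩
    sum (applyUpTo (λ r → occurrences (U r) (part (λs ⊕ μs) r) (suc c)) rows)
      ≡⟨ cong sum (applyUpTo-cong (λ r → U-occurrences r c) rows) ⟩
    sum (applyUpTo (λ r → symbolOccurrences r (unmerge c)) rows)
      ≡⟨ symbol-count (unmerge c) ⟩
    height (unmerge c)
      ≡⟨ height-unmerge c ⟩
    conj (λs ⊕ μs) (suc c)
      ∎
    where open ≡-Reasoning

  U-pos : Positive (λs ⊕ μs) U
  U-pos _ _ _ = s≤s z≤n

  U-rows : RowsDistinct (λs ⊕ μs) U
  U-rows r c c' c< c'< c≢c' = c≢c' ∘ U-row-injective r (inShape-⊕ c<) (inShape-⊕ c'<)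

  U-cols : ColumnsDistinct (λs ⊕ μs) U
  U-cols r r' c c< c<' r≢r' = r≢r' ∘ U-column-injective (inShape-⊕ c<) (inShape-⊕ c<')

proposition8 : (λs μs : List ℕ) → IsPartition λs → IsPartition μs →
    Latin λs → Latin μs → Latin (λs ⊕ μs)
proposition8 λs μs (λ-sorted , _) (μ-sorted , _)
             (T , T-pos , T-rows , T-cols , T-counts) (S , S-pos , S-rows , S-cols , S-counts) =
  U , U-pos , U-rows , U-cols , U-counts
  where
  open SumTableau λs μs (part-antitone λ-sorted) (part-antitone μ-sorted)
                  T-pos T-rows T-cols T-counts S-pos S-rows S-cols S-counts
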